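{- Let $T$ be a tree and $C_6$ the cycle of length $6$. Then $\chi_s'(T\Box C_6)\le 2\Delta(T)+6$.
   Context: $\Delta(T)$ is the maximum degree of $T$. The Cartesian product $G\Box H$ has vertex set $V(G)\times V(H)$, with $(a,u)\sim(b,v)$ iff either $a=b$ and $uv\in E(H)$, or $u=v$ and $ab\in E(G)$. A strong edge coloring is a proper edge coloring in which every color class is an induced matching; $\chi_s'(G)$ is the minimum number of colors in such a coloring. -}

module Defs where

open import Data.Nat using (ℕ; zero; suc; _+_; _*_; _≤_; _⊔_; _%_; _≡ᵇ_)
open import Data.Fin using (Fin; toℕ)
open import Data.Bool using (Bool; true; false; if_then_else_; _∨_; _∧_)
open import Data.List using (List; []; _∷_; _++_; [_]; length; map; foldr; allFin)
open import Data.Nat.ListAction using (sum)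
open import Data.List.Relation.Unary.Unique.Propositional using (Unique)
open import Data.List.Relation.Unary.Linked using (Linked)
open import Data.Product using (Σ; _×_; _,_)
open import Data.Sum using (_⊎_)
open import Relation.Binary.PropositionalEquality using (_≡_; _≢_)
open import Relation.Nullary using (¬_)

record Graph : Set where
  field
    n      : ℕ
    adj    : Fin n → Fin n → Bool
    sym    : ∀ i j → adj i j ≡ adj j i
    irrefl : ∀ i → adj i i ≡ false
open Graph public

data Walk (G : Graph) : Fin (n G) → Fin (n G) → Set where
  here : ∀ {u} → Walk G u u
  step : ∀ {u w v} → adj G u w ≡ true → Walk G w v → Walk G u v

Connected : Graph → Set
Connected G = ∀ u v → Walk G u v

-- A cycle: a list v₀ … v_{k-1} of k ≥ 3 distinct vertices with consecutive
-- vertices adjacent and v_{k-1} adjacent to v₀.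
IsCycle : (G : Graph) → List (Fin (n G)) → Set
IsCycle G [] = ¬ (0 ≡ 0)
IsCycle G (v ∷ vs) =
  (2 ≤ length vs) × Unique (v ∷ vs) ×
  Linked (λ a b → adj G a b ≡ true) ((v ∷ vs) ++ [ v ])

Acyclic : Graph → Set
Acyclic G = ∀ vs → ¬ IsCycle G vs

IsTree : Graph → Set
IsTree G = Connected G × Acyclic G

degree : (G : Graph) → Fin (n G) → ℕ
degree G v = sum (map (λ u → if adj G v u then 1 else 0) (allFin (n G)))

-- maximum degree Δ(G) (0 for the empty graph)
Δ : Graph → ℕ
Δ G = foldr _⊔_ 0 (map (degree G) (allFin (n G)))

C6adj : Fin 6 → Fin 6 → Bool
C6adj i j = ((suc (toℕ i) % 6) ≡ᵇ toℕ j) ∨ ((suc (toℕ j) % 6) ≡ᵇ toℕ i)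

□adj : ∀ {A B : Set} → (A → A → Bool) → (B → B → Bool) → (A → A → Bool)
     → (B → B → Bool) → A × B → A × B → Bool
□adj adjG adjH eqG eqH (a , u) (b , v) = (eqG a b ∧ adjH u v) ∨ (eqH u v ∧ adjG a b)

-- Strong edge coloring with k colors of the graph with adjacency `adj` on V:
-- c assigns a color to each edge (symmetric in its endpoints), and any two
-- edges with the same color are either the same edge or form an induced
-- matching (disjoint endpoints and no edge joining them).
SameEdge : ∀ {V : Set} → V → V → V → V → Set
SameEdge u v x y = (u ≡ x × v ≡ y) ⊎ (u ≡ y × v ≡ x)

Apart : ∀ {V : Set} → (V → V → Bool) → V → V → Set
Apart adj a b = (a ≢ b) × (adj a b ≡ false)

Separated : ∀ {V : Set} → (V → V → Bool) → V → V → V → V → Set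
Separated adj u v x y =
  Apart adj u x × Apart adj u y × Apart adj v x × Apart adj v y

StrongEdgeColoring : ∀ {V : Set} → (V → V → Bool) → ℕ → Set
StrongEdgeColoring {V} adj k =
  Σ (V → V → Fin k) λ c →
    (∀ u v → adj u v ≡ true → c u v ≡ c v u) ×
    (∀ u v x y → adj u v ≡ true → adj x y ≡ true → c u v ≡ c x y →
       SameEdge u v x y ⊎ Separated adj u v x y)

module Submission where

open import Defs renaming (sym to adj-sym)
open import Data.Nat
  using (ℕ; zero; suc; pred; _+_; _*_; _%_; _⊔_; _≤_; _<_; z≤n; s≤s; s≤s⁻¹; _<?_; _≡ᵇ_; NonZero; >-nonZero; parity)
import Data.Nat.Properties as ℕ
open import Data.Nat.Properties
  using ( ≤-refl; ≤-reflexive; ≤-trans; ≤-antisym; ≤-pred; <-irrefl; <-asym; <-trans; <-≤-trans; <-cmp; <⇒≢; ≮⇒≥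
        ; n≤1+n; 1+n≰n; n≤0⇒n≡0; m<n⇒0<n; m≤m+n; m≤m⊔n; m≤n⊔m; suc-pred; suc-injective
        ; +-comm; *-comm; +-cancelˡ-≡; *-cancelʳ-≡; +-mono-≤; +-mono-≤-<; +-mono-<-≤; +-monoˡ-<; +-monoʳ-<; *-monoˡ-≤
        ; module ≤-Reasoning)
open import Data.Nat.DivMod using (_mod_; m%n<n; m<n⇒m%n≡m; [m+kn]%n≡m%n)
open import Data.Nat.ListAction using (sum)
open import Data.Fin as Fin using (Fin; toℕ)
open import Data.Fin.Properties using (_≟_; any?; all?; toℕ-injective; toℕ-fromℕ<)
open import Data.Bool using (Bool; true; false; if_then_else_; _∧_; _∨_)
import Data.Bool.Properties as Bool
open import Data.Parity.Base using (Parity; 0ℙ; 1ℙ; _⁻¹) renaming (_+_ to _⊕_)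
import Data.Parity.Properties as Parity
open import Data.Parity.Properties using (⁻¹-involutive; ⁻¹-selfInverse; suc-homo-⁻¹; p≢p⁻¹)
open import Data.List using (List; []; _∷_; _++_; [_]; length; map; foldr; allFin)
open import Data.List.Properties using (length-++)
open import Data.List.Membership.Propositional using (_∈_)
open import Data.List.Membership.Propositional.Properties using (∈-allFin)
open import Data.List.Relation.Unary.Any using (here; there)
open import Data.List.Relation.Unary.All as All using (All; []; _∷_)
import Data.List.Relation.Unary.All.Properties as All
open import Data.List.Relation.Unary.AllPairs using ([]; _∷_)
open import Data.List.Relation.Unary.Unique.Propositional using (Unique)
open import Data.List.Relation.Unary.Linked using (Linked; []; [-]; _∷_)
open import Data.Product using (Σ; ∃-syntax; _×_; _,_; proj₁; proj₂)
open import Data.Product.Properties using (≡-dec)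
open import Data.Sum using (_⊎_; inj₁; inj₂; [_,_]′)
open import Data.Empty using (⊥; ⊥-elim)
open import Function using (_∘_)
open import Relation.Nullary using (¬_; Dec; does; yes; no; contradiction)
open import Relation.Nullary.Decidable
  using (⌊_⌋; _⊎-dec_; _×-dec_; _→-dec_; ¬?; from-yes; dec-true; dec-false; isYes≗does)
open import Relation.Unary using (Decidable)
open import Relation.Binary.Definitions using (DecidableEquality; tri<; tri≈; tri>)
open import Relation.Binary.PropositionalEquality hiding ([_])

-- Root T and label each edge {v, parent v} by a number ℓ(v) < Δ(T) so that edges sharing a vertex get
-- different labels: the children of v are numbered skipping the label of the edge above v. The phase of v is
-- φ(v) = depth v + #{edges labelled ℓ(v) on the path from v to the root} mod 2. The copy of the edge
-- {v, parent v} in layer i of T □ C₆ is coloured by the pair (ℓ(v), φ(v) + i mod 2), and the edge {i, j} of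
-- the copy of C₆ at the tree vertex a by (i + j) mod 3, shifted by 3 when depth a is odd: 2Δ(T) + 6 colours.
-- Equal C₆-colours occur only on opposite edges of one C₆ or on the C₆'s of non-adjacent tree vertices. Two
-- tree edges with equal labels at distance one lie on a path of three edges climbing either to a grandparent
-- or down again to an uncle, and in both cases their phases differ; in adjacent layers, two tree edges meeting
-- at a common vertex with equal labels are the same edge, whose copies differ in the parity of i.

least : {P : ℕ → Set} → Decidable P → ℕ → ℕ
least P? zero = zero
least P? (suc b) with P? zero
... | yes _ = zero
... | no _ = suc (least (P? ∘ suc) b)

least-satisfies : {P : ℕ → Set} (P? : Decidable P) (b : ℕ) → P b → P (least P? b)
least-satisfies P? zero p = p
least-satisfies P? (suc b) p with P? zero
... | yes p₀ = p₀
... | no _ = least-satisfies (P? ∘ suc) b p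

least-minimal : {P : ℕ → Set} (P? : Decidable P) (b : ℕ) {k : ℕ} → P k → least P? b ≤ k
least-minimal P? zero p = z≤n
least-minimal P? (suc b) {k} p with P? zero
... | yes _ = z≤n
least-minimal P? (suc b) {zero} p | no ¬p₀ = contradiction p ¬p₀
least-minimal P? (suc b) {suc k} p | no _ = s≤s (least-minimal (P? ∘ suc) b p)

count : {A : Set} → (A → Bool) → List A → ℕ
count f xs = sum (map (λ x → if f x then 1 else 0) xs)

indicator-mono : ∀ {a b : Bool} → (a ≡ true → b ≡ true) → (if a then 1 else 0) ≤ (if b then 1 else 0)
indicator-mono {false} _ = z≤n
indicator-mono {true} a⇒b rewrite a⇒b refl = ≤-refl

count-mono : {A : Set} {f g : A → Bool} (xs : List A) → (∀ x → f x ≡ true → g x ≡ true) → count f xs ≤ count g xs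
count-mono [] _ = z≤n
count-mono (x ∷ xs) f⇒g = +-mono-≤ (indicator-mono (f⇒g x)) (count-mono xs f⇒g)

count-mono-< : {A : Set} {f g : A → Bool} {x : A} {xs : List A} → (∀ y → f y ≡ true → g y ≡ true) →
  x ∈ xs → f x ≡ false → g x ≡ true → count f xs < count g xs
count-mono-< {xs = _ ∷ xs} f⇒g (here refl) fx gx rewrite fx | gx = s≤s (count-mono xs f⇒g)
count-mono-< {xs = y ∷ _} f⇒g (there x∈xs) fx gx = +-mono-≤-< (indicator-mono (f⇒g y)) (count-mono-< f⇒g x∈xs fx gx)

≤-foldr-⊔ : {A : Set} (f : A → ℕ) {x : A} {xs : List A} → x ∈ xs → f x ≤ foldr _⊔_ 0 (map f xs)
≤-foldr-⊔ f (here refl) = m≤m⊔n _ _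
≤-foldr-⊔ f (there x∈xs) = ≤-trans (≤-foldr-⊔ f x∈xs) (m≤n⊔m _ _)

degree≤Δ : ∀ G v → degree G v ≤ Δ G
degree≤Δ G v = ≤-foldr-⊔ (degree G) (∈-allFin v)

punchInℕ : ℕ → ℕ → ℕ
punchInℕ L s with s <? L
... | yes _ = s
... | no _ = suc s

punchInℕ-≢ : ∀ L s → punchInℕ L s ≢ L
punchInℕ-≢ L s with s <? L
... | yes s<L = <⇒≢ s<L
... | no s≮L = λ 1+s≡L → s≮L (≤-reflexive 1+s≡L)

punchInℕ-injective : ∀ L s s′ → punchInℕ L s ≡ punchInℕ L s′ → s ≡ s′
punchInℕ-injective L s s′ eq with s <? L | s′ <? L
... | yes _ | yes _ = eq
... | no _ | no _ = suc-injective eq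
... | yes s<L | no s′≮L = contradiction (≤-trans (n≤1+n _) (subst (_< L) eq s<L)) s′≮L
... | no s≮L | yes s′<L = contradiction (≤-trans (n≤1+n _) (subst (_< L) (sym eq) s′<L)) s≮L

punchInℕ≤suc : ∀ L s → punchInℕ L s ≤ suc s
punchInℕ≤suc L s with s <? L
... | yes _ = n≤1+n s
... | no _ = ≤-refl

punchInℕ-< : ∀ {L s} → s < L → punchInℕ L s ≡ s
punchInℕ-< {L} {s} s<L with s <? L
... | yes _ = refl
... | no s≮L = contradiction s<L s≮L

divMod-injective : ∀ k .{{_ : NonZero k}} {x y q r} → x < k → y < k → x + q * k ≡ y + r * k → x ≡ y × q ≡ r
divMod-injective k {x} {y} {q} {r} x<k y<k eq =
  x≡y , *-cancelʳ-≡ q r k (+-cancelˡ-≡ x _ _ (trans eq (cong (_+ r * k) (sym x≡y))))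
  where
  open ≡-Reasoning
  x≡y : x ≡ y
  x≡y = begin
    x                ≡⟨ m<n⇒m%n≡m x<k ⟨
    x % k            ≡⟨ [m+kn]%n≡m%n x q k ⟨
    (x + q * k) % k  ≡⟨ cong (_% k) eq ⟩
    (y + r * k) % k  ≡⟨ [m+kn]%n≡m%n y r k ⟩
    y % k            ≡⟨ m<n⇒m%n≡m y<k ⟩
    y                ∎

mod-injective : ∀ {k} .{{_ : NonZero k}} {m m′} → m < k → m′ < k → m mod k ≡ m′ mod k → m ≡ m′
mod-injective {k} {m} {m′} m<k m′<k eq = begin
  m               ≡⟨ m<n⇒m%n≡m m<k ⟨
  m % k           ≡⟨ toℕ-fromℕ< (m%n<n m k) ⟨
  toℕ (m mod k)   ≡⟨ cong toℕ eq ⟩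
  toℕ (m′ mod k)  ≡⟨ toℕ-fromℕ< (m%n<n m′ k) ⟩
  m′ % k          ≡⟨ m<n⇒m%n≡m m′<k ⟩
  m′              ∎
  where open ≡-Reasoning

bit : Parity → ℕ
bit 0ℙ = 0
bit 1ℙ = 1

bit<2 : ∀ p → bit p < 2
bit<2 0ℙ = s≤s z≤n
bit<2 1ℙ = s≤s (s≤s z≤n)

bit-injective : ∀ {p q} → bit p ≡ bit q → p ≡ q
bit-injective {0ℙ} {0ℙ} _ = refl
bit-injective {1ℙ} {1ℙ} _ = refl

p⊕q⁻¹≡[p⊕q]⁻¹ : ∀ p q → p ⊕ q ⁻¹ ≡ (p ⊕ q) ⁻¹
p⊕q⁻¹≡[p⊕q]⁻¹ 0ℙ q = refl
p⊕q⁻¹≡[p⊕q]⁻¹ 1ℙ q = refl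

p⁻¹⊕q≡[p⊕q]⁻¹ : ∀ p q → p ⁻¹ ⊕ q ≡ (p ⊕ q) ⁻¹
p⁻¹⊕q≡[p⊕q]⁻¹ 0ℙ q = refl
p⁻¹⊕q≡[p⊕q]⁻¹ 1ℙ q = sym (⁻¹-involutive q)

parity-suc : ∀ n → parity (suc n) ≡ parity n ⁻¹
parity-suc n = sym (⁻¹-selfInverse (suc-homo-⁻¹ n))

does⇒ : {A : Set} (a? : Dec A) → does a? ≡ true → A
does⇒ (yes a) _ = a

⌊⌋⇒ : {A : Set} (a? : Dec A) → ⌊ a? ⌋ ≡ true → A
⌊⌋⇒ a? e = does⇒ a? (trans (sym (isYes≗does a?)) e)

⌊⌋-refl : {A : Set} (_≟A_ : DecidableEquality A) (a : A) → ⌊ a ≟A a ⌋ ≡ true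
⌊⌋-refl _≟A_ a = trans (isYes≗does (a ≟A a)) (dec-true (a ≟A a) refl)

∧≡true⇒ : ∀ {x y} → x ∧ y ≡ true → x ≡ true × y ≡ true
∧≡true⇒ {true} {true} _ = refl , refl

∨≡true⇒ : ∀ {x y} → x ∨ y ≡ true → x ≡ true ⊎ y ≡ true
∨≡true⇒ {true} _ = inj₁ refl
∨≡true⇒ {false} e = inj₂ e

linked-∷ʳ : ∀ {A : Set} {R : A → A → Set} {x} ys {y z} →
  Linked R (x ∷ ys ++ [ y ]) → R y z → Linked R (x ∷ (ys ++ [ y ]) ++ [ z ])
linked-∷ʳ [] (r ∷ [-]) r′ = r ∷ r′ ∷ [-]
linked-∷ʳ (_ ∷ ys) (r ∷ rs) r′ = r ∷ linked-∷ʳ ys rs r′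

unique-∷ʳ : ∀ {A : Set} (xs : List A) {y} → Unique xs → All (_≢ y) xs → Unique (xs ++ [ y ])
unique-∷ʳ [] _ _ = [] ∷ []
unique-∷ʳ (_ ∷ xs) (x∉ ∷ u) (x≢y ∷ xs≢y) = All.++⁺ x∉ (x≢y ∷ []) ∷ unique-∷ʳ xs u xs≢y

-- Strong edge colourings from a local condition

Close : {V : Set} → (V → V → Bool) → V → V → Set
Close E x y = x ≡ y ⊎ E x y ≡ true

sameEdge-map : ∀ {A B : Set} (f : A → B) {a b a′ b′} → SameEdge a b a′ b′ → SameEdge (f a) (f b) (f a′) (f b′)
sameEdge-map f (inj₁ (refl , refl)) = inj₁ (refl , refl)
sameEdge-map f (inj₂ (refl , refl)) = inj₂ (refl , refl)

sameEdge-swapˡ : ∀ {A : Set} {u v x y : A} → SameEdge v u x y → SameEdge u v x y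
sameEdge-swapˡ (inj₁ (vx , uy)) = inj₂ (uy , vx)
sameEdge-swapˡ (inj₂ (vy , ux)) = inj₁ (ux , vy)

sameEdge-swapʳ : ∀ {A : Set} {u v x y : A} → SameEdge u v y x → SameEdge u v x y
sameEdge-swapʳ (inj₁ (uy , vx)) = inj₂ (uy , vx)
sameEdge-swapʳ (inj₂ (ux , vy)) = inj₁ (ux , vy)

module _ {V : Set} (_≟V_ : DecidableEquality V) {E : V → V → Bool} (E-sym : ∀ {x y} → E x y ≡ true → E y x ≡ true)
         (c : V → V → ℕ) (c-sym : ∀ {x y} → E x y ≡ true → c x y ≡ c y x) where

  close-or-apart : ∀ x y → Close E x y ⊎ Apart E x y
  close-or-apart x y with x ≟V y | E x y
  ... | yes x≡y | _ = inj₁ (inj₁ x≡y)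
  ... | no _ | true = inj₁ (inj₂ refl)
  ... | no x≢y | false = inj₂ (x≢y , refl)

  strong-from-close :
    (∀ {u v x y} → E u v ≡ true → E x y ≡ true → c u v ≡ c x y → Close E u x → SameEdge u v x y) →
    ∀ {u v x y} → E u v ≡ true → E x y ≡ true → c u v ≡ c x y → SameEdge u v x y ⊎ Separated E u v x y
  strong-from-close close {u} {v} {x} {y} uv xy c≡
    with close-or-apart u x | close-or-apart u y | close-or-apart v x | close-or-apart v y
  ... | inj₁ ux | _ | _ | _ = inj₁ (close uv xy c≡ ux)
  ... | inj₂ _ | inj₁ uy | _ | _ = inj₁ (sameEdge-swapʳ (close uv (E-sym xy) (trans c≡ (c-sym xy)) uy))
  ... | inj₂ _ | inj₂ _ | inj₁ vx | _ = inj₁ (sameEdge-swapˡ (close (E-sym uv) xy (trans (sym (c-sym uv)) c≡) vx))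
  ... | inj₂ _ | inj₂ _ | inj₂ _ | inj₁ vy =
    inj₁ (sameEdge-swapˡ (sameEdge-swapʳ
      (close (E-sym uv) (E-sym xy) (trans (sym (c-sym uv)) (trans c≡ (c-sym xy))) vy)))
  ... | inj₂ ux | inj₂ uy | inj₂ vx | inj₂ vy = inj₂ (ux , uy , vx , vy)

  strongEdgeColoring : ∀ k .{{_ : NonZero k}} → (∀ {x y} → E x y ≡ true → c x y < k) →
    (∀ {u v x y} → E u v ≡ true → E x y ≡ true → c u v ≡ c x y → Close E u x → SameEdge u v x y) →
    StrongEdgeColoring E k
  strongEdgeColoring k c<k close =
    (λ x y → c x y mod k) , (λ _ _ uv → cong (λ m → m mod k) (c-sym uv)) ,
    (λ _ _ _ _ uv xy eq → strong-from-close close uv xy (mod-injective (c<k uv) (c<k xy) eq))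

strongEdgeColoring-empty : ∀ {V : Set} {E : V → V → Bool} {k} → ¬ V → StrongEdgeColoring E k
strongEdgeColoring-empty ¬V = (λ x → ⊥-elim (¬V x)) , (λ u → ⊥-elim (¬V u)) , (λ u → ⊥-elim (¬V u))

module _ {A B : Set} (_≟A_ : DecidableEquality A) (_≟B_ : DecidableEquality B)
         (adjA : A → A → Bool) (adjB : B → B → Bool) where

  □-edge : ∀ {a u b v} → □adj adjA adjB (λ a b → ⌊ a ≟A b ⌋) (λ u v → ⌊ u ≟B v ⌋) (a , u) (b , v) ≡ true →
    (a ≡ b × adjB u v ≡ true) ⊎ (u ≡ v × adjA a b ≡ true)
  □-edge {a} {u} {b} {v} e with ∨≡true⇒ e
  ... | inj₁ h = inj₁ (⌊⌋⇒ (a ≟A b) (proj₁ (∧≡true⇒ h)) , proj₂ (∧≡true⇒ h))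
  ... | inj₂ h = inj₂ (⌊⌋⇒ (u ≟B v) (proj₁ (∧≡true⇒ h)) , proj₂ (∧≡true⇒ h))

  □-sym : (∀ {a b} → adjA a b ≡ true → adjA b a ≡ true) → (∀ {u v} → adjB u v ≡ true → adjB v u ≡ true) →
    ∀ {x y} → □adj adjA adjB (λ a b → ⌊ a ≟A b ⌋) (λ u v → ⌊ u ≟B v ⌋) x y ≡ true →
    □adj adjA adjB (λ a b → ⌊ a ≟A b ⌋) (λ u v → ⌊ u ≟B v ⌋) y x ≡ true
  □-sym symA symB {a , u} {b , v} e with □-edge e
  ... | inj₁ (refl , uv) = cong (_∨ _) (cong₂ _∧_ (⌊⌋-refl _≟A_ a) (symB uv))
  ... | inj₂ (refl , ab) = trans (cong (_ ∨_) (cong₂ _∧_ (⌊⌋-refl _≟B_ u) (symA ab))) (Bool.∨-zeroʳ _)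

Adjacent : (G : Graph) → Fin (n G) → Fin (n G) → Set
Adjacent G a b = adj G a b ≡ true

adjacent-sym : ∀ G {a b} → Adjacent G a b → Adjacent G b a
adjacent-sym G {a} {b} = trans (adj-sym G b a)

adjacent⇒≢ : ∀ G {a b} → Adjacent G a b → a ≢ b
adjacent⇒≢ G {a} ab refl with trans (sym ab) (irrefl G a)
... | ()

C6-sym : ∀ i j → C6adj i j ≡ true → C6adj j i ≡ true
C6-sym i j = trans (Bool.∨-comm ((suc (toℕ j) % 6) ≡ᵇ toℕ i) ((suc (toℕ i) % 6) ≡ᵇ toℕ j))

C6-parity : ∀ i j → C6adj i j ≡ true → parity (toℕ i) ≢ parity (toℕ j)
C6-parity = from-yes (all? λ i → all? λ j →
  (C6adj i j Bool.≟ true) →-dec ¬? (parity (toℕ i) Parity.≟ parity (toℕ j)))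

C6-strong : ∀ i j i′ j′ → C6adj i j ≡ true → C6adj i′ j′ ≡ true → i ≡ i′ ⊎ C6adj i i′ ≡ true →
  (toℕ i + toℕ j) % 3 ≡ (toℕ i′ + toℕ j′) % 3 → SameEdge i j i′ j′
C6-strong = from-yes (all? λ i → all? λ j → all? λ i′ → all? λ j′ →
  (C6adj i j Bool.≟ true) →-dec (C6adj i′ j′ Bool.≟ true) →-dec ((i ≟ i′) ⊎-dec (C6adj i i′ Bool.≟ true)) →-dec
  ((toℕ i + toℕ j) % 3 ℕ.≟ (toℕ i′ + toℕ j′) % 3) →-dec
  (((i ≟ i′) ×-dec (j ≟ j′)) ⊎-dec ((i ≟ j′) ×-dec (j ≟ i′))))

-- Rooting a tree

record RootedTree (T : Graph) : Set where
  field
    depth        : Fin (n T) → ℕ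
    parent       : Fin (n T) → Fin (n T)
    parent-adj   : ∀ {v} → 0 < depth v → Adjacent T v (parent v)
    depth-parent : ∀ {v} → 0 < depth v → depth v ≡ suc (depth (parent v))
    edge-parent  : ∀ {a b} → Adjacent T a b → (0 < depth a × parent a ≡ b) ⊎ (0 < depth b × parent b ≡ a)

module Rooting (T : Graph) (tree : IsTree T) (root : Fin (n T)) where

  private
    V = Fin (n T)
    Adj = Adjacent T

  ReachesIn : ℕ → V → Set
  ReachesIn zero v = v ≡ root
  ReachesIn (suc k) v = ReachesIn k v ⊎ ∃[ u ] Adj v u × ReachesIn k u

  reachesIn? : ∀ k → Decidable (ReachesIn k)
  reachesIn? zero v = v ≟ root
  reachesIn? (suc k) v = reachesIn? k v ⊎-dec any? (λ u → (adj T v u Bool.≟ true) ×-dec reachesIn? k u)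

  walk⇒reachesIn : ∀ {v} → Walk T v root → ∃[ k ] ReachesIn k v
  walk⇒reachesIn here = zero , refl
  walk⇒reachesIn (step {w = u} e w) with walk⇒reachesIn w
  ... | k , r = suc k , inj₂ (u , e , r)

  reachesIn : ∀ v → ∃[ k ] ReachesIn k v
  reachesIn v = walk⇒reachesIn (proj₁ tree v root)

  depth : V → ℕ
  depth v = least (λ k → reachesIn? k v) (proj₁ (reachesIn v))

  depth-reaches : ∀ v → ReachesIn (depth v) v
  depth-reaches v = least-satisfies (λ k → reachesIn? k v) (proj₁ (reachesIn v)) (proj₂ (reachesIn v))

  depth-minimal : ∀ {v k} → ReachesIn k v → depth v ≤ k
  depth-minimal {v} = least-minimal (λ k → reachesIn? k v) (proj₁ (reachesIn v))

  depth≡0⇒root : ∀ {v} → depth v ≡ 0 → v ≡ root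
  depth≡0⇒root {v} e = subst (λ k → ReachesIn k v) e (depth-reaches v)

  depth-adj : ∀ {a b} → Adj a b → depth a ≤ suc (depth b)
  depth-adj {b = b} e = depth-minimal (inj₂ (b , e , depth-reaches b))

  towardRoot : ℕ → V → V
  towardRoot zero v = v
  towardRoot (suc t) v with any? (λ u → (adj T v u Bool.≟ true) ×-dec reachesIn? t u)
  ... | yes (u , _) = u
  ... | no _ = v

  towardRoot-spec : ∀ t v → ReachesIn (suc t) v → ¬ ReachesIn t v →
    Adj v (towardRoot (suc t) v) × ReachesIn t (towardRoot (suc t) v)
  towardRoot-spec t v r ¬r with any? (λ u → (adj T v u Bool.≟ true) ×-dec reachesIn? t u)
  towardRoot-spec t v r ¬r | yes (_ , next) = next
  towardRoot-spec t v (inj₁ r) ¬r | no _ = contradiction r ¬r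
  towardRoot-spec t v (inj₂ r) ¬r | no ¬next = contradiction r ¬next

  parent : V → V
  parent v = towardRoot (depth v) v

  parent-spec : ∀ {v t} → depth v ≡ suc t → Adj v (parent v) × depth (parent v) ≡ t
  parent-spec {v} {t} e = subst (λ u → Adj v u × depth u ≡ t) (cong (λ k → towardRoot k v) (sym e))
    (adj-next , ≤-antisym (depth-minimal reaches-next) t≤depth)
    where
    next = towardRoot-spec t v (subst (λ k → ReachesIn k v) e (depth-reaches v))
                          (λ r → 1+n≰n (subst (_≤ t) e (depth-minimal r)))
    adj-next = proj₁ next
    reaches-next = proj₂ next
    t≤depth : t ≤ depth (towardRoot (suc t) v)
    t≤depth = s≤s⁻¹ (subst (_≤ suc (depth (towardRoot (suc t) v))) e (depth-adj adj-next))

  nonRoot-parent : ∀ {v} → 0 < depth v → Adj v (parent v) × depth v ≡ suc (depth (parent v))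
  nonRoot-parent {v} 0<d = adj-parent , trans (sym d≡) (cong suc (sym d-parent))
    where
    d≡ : suc (pred (depth v)) ≡ depth v
    d≡ = suc-pred (depth v) {{>-nonZero 0<d}}
    adj-parent = proj₁ (parent-spec (sym d≡))
    d-parent = proj₂ (parent-spec (sym d≡))

  record LowPath (t : ℕ) (x y : V) : Set where
    field
      inner    : List V
      nonempty : 1 ≤ length inner
      unique   : Unique (x ∷ inner ++ [ y ])
      linked   : Linked Adj (x ∷ inner ++ [ y ])
      low      : All (λ z → depth z ≤ t) (x ∷ inner ++ [ y ])

  deeper-≢ : ∀ {a t zs} → depth a ≡ suc t → All (λ z → depth z ≤ t) zs → All (a ≢_) zs
  deeper-≢ da = All.map (λ z≤t a≡z → 1+n≰n (subst (_≤ _) (trans (sym (cong depth a≡z)) da) z≤t))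

  lowPath : ∀ t {x y} → depth x ≡ t → depth y ≡ t → x ≢ y → LowPath t x y
  lowPath zero dx dy x≢y = contradiction (trans (depth≡0⇒root dx) (sym (depth≡0⇒root dy))) x≢y
  lowPath (suc t) {x} {y} dx dy x≢y with parent-spec dx | parent-spec dy | parent x ≟ parent y
  ... | ax , dpx | ay , dpy | yes px≡py = record
    { inner    = [ parent x ]
    ; nonempty = s≤s z≤n
    ; unique   = (adjacent⇒≢ T ax ∷ x≢y ∷ [])
                 ∷ ((λ px≡y → adjacent⇒≢ T ay (sym (trans (sym px≡py) px≡y))) ∷ []) ∷ [] ∷ []
    ; linked   = ax ∷ subst (λ u → Adj u y) (sym px≡py) (adjacent-sym T ay) ∷ [-]
    ; low      = ≤-reflexive dx ∷ ≤-trans (≤-reflexive dpx) (n≤1+n t) ∷ ≤-reflexive dy ∷ []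
    }
  ... | ax , dpx | ay , dpy | no px≢py = record
    { inner    = parent x ∷ P.inner ++ [ parent y ]
    ; nonempty = s≤s z≤n
    ; unique   = All.++⁺ (deeper-≢ dx P.low) (x≢y ∷ [])
                 ∷ unique-∷ʳ (parent x ∷ P.inner ++ [ parent y ]) P.unique (All.map (_∘ sym) (deeper-≢ dy P.low))
    ; linked   = ax ∷ linked-∷ʳ P.inner P.linked (adjacent-sym T ay)
    ; low      = ≤-reflexive dx ∷ All.++⁺ (All.map (λ z≤t → ≤-trans z≤t (n≤1+n t)) P.low) (≤-reflexive dy ∷ [])
    }
    where module P = LowPath (lowPath t dpx dpy px≢py)

  closeCycle : ∀ x ys y → 1 ≤ length ys → Unique (x ∷ ys ++ [ y ]) → Linked Adj (x ∷ ys ++ [ y ]) →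
    Adj y x → IsCycle T (x ∷ ys ++ [ y ])
  closeCycle x ys y nonempty unique linked yx =
    subst (2 ≤_) (sym (length-++ ys)) (+-mono-≤ nonempty ≤-refl) , unique , linked-∷ʳ ys linked yx

  adj⇒depth≢ : ∀ {a b} → Adj a b → depth a ≢ depth b
  adj⇒depth≢ {a} {b} ab da≡db =
    proj₂ tree _ (closeCycle a P.inner b P.nonempty P.unique P.linked (adjacent-sym T ab))
    where module P = LowPath (lowPath (depth b) da≡db refl (adjacent⇒≢ T ab))

  deeper⇒parent : ∀ {a b} → Adj a b → depth a ≡ suc (depth b) → parent a ≡ b
  deeper⇒parent {a} {b} ab da with parent a ≟ b | parent-spec da
  ... | yes pa≡b | _ = pa≡b
  ... | no pa≢b | a-pa , dpa = ⊥-elim (proj₂ tree _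
    (closeCycle a (parent a ∷ P.inner) b (s≤s z≤n)
      (deeper-≢ da P.low ∷ P.unique) (a-pa ∷ P.linked) (adjacent-sym T ab)))
    where module P = LowPath (lowPath (depth b) dpa refl pa≢b)

  edge-parent : ∀ {a b} → Adj a b → (0 < depth a × parent a ≡ b) ⊎ (0 < depth b × parent b ≡ a)
  edge-parent {a} {b} ab with <-cmp (depth a) (depth b)
  ... | tri≈ _ da≡db _ = contradiction da≡db (adj⇒depth≢ ab)
  ... | tri< da<db _ _ =
    inj₂ (m<n⇒0<n da<db , deeper⇒parent (adjacent-sym T ab) (≤-antisym (depth-adj (adjacent-sym T ab)) da<db))
  ... | tri> _ _ da>db = inj₁ (m<n⇒0<n da>db , deeper⇒parent ab (≤-antisym (depth-adj ab) da>db))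

  rootedTree : RootedTree T
  rootedTree = record
    { depth        = depth
    ; parent       = parent
    ; parent-adj   = proj₁ ∘ nonRoot-parent
    ; depth-parent = proj₂ ∘ nonRoot-parent
    ; edge-parent  = edge-parent
    }

-- Labelling the edges of a rooted tree

module EdgeLabelling {T : Graph} (R : RootedTree T) where
  open RootedTree R

  private
    V = Fin (n T)
    Adj = Adjacent T

  NonRoot : V → Set
  NonRoot v = 0 < depth v

  ChildOf : V → V → Set
  ChildOf x v = NonRoot v × parent v ≡ x

  childOf? : ∀ x v → Dec (ChildOf x v)
  childOf? x v = (0 <? depth v) ×-dec (parent v ≟ x)

  childOf-depth : ∀ {x v} → ChildOf x v → depth v ≡ suc (depth x)
  childOf-depth (nr , refl) = depth-parent nr

  childOf-asym : ∀ {a b} → ChildOf a b → ChildOf b a → ⊥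
  childOf-asym ab ba = <-asym (≤-reflexive (sym (childOf-depth ab))) (≤-reflexive (sym (childOf-depth ba)))

  childOf⇒adj : ∀ {x v} → ChildOf x v → Adj x v
  childOf⇒adj (nr , refl) = adjacent-sym T (parent-adj nr)

  children : V → ℕ
  children x = count (does ∘ childOf? x) (allFin (n T))

  children<degree : ∀ {x} → NonRoot x → children x < degree T x
  children<degree {x} nr = count-mono-< (λ v c → childOf⇒adj (does⇒ (childOf? x v) c)) (∈-allFin (parent x))
    (dec-false (childOf? x (parent x)) (childOf-asym (nr , refl))) (parent-adj nr)

  children≤degree : ∀ x → children x ≤ degree T x
  children≤degree x = count-mono (allFin (n T)) (λ v c → childOf⇒adj (does⇒ (childOf? x v) c))

  OlderSibling : V → V → Set
  OlderSibling v u = toℕ u < toℕ v × ChildOf (parent v) u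

  olderSibling? : ∀ v u → Dec (OlderSibling v u)
  olderSibling? v u = (toℕ u <? toℕ v) ×-dec childOf? (parent v) u

  rank : V → ℕ
  rank v = count (does ∘ olderSibling? v) (allFin (n T))

  rank<children : ∀ {v} → NonRoot v → rank v < children (parent v)
  rank<children {v} nr =
    count-mono-< (λ u h → dec-true (childOf? (parent v) u) (proj₂ (does⇒ (olderSibling? v u) h))) (∈-allFin v)
      (dec-false (olderSibling? v v) (<-irrefl refl ∘ proj₁)) (dec-true (childOf? (parent v) v) (nr , refl))

  rank-mono : ∀ {x V W} → ChildOf x V → ChildOf x W → toℕ V < toℕ W → rank V < rank W
  rank-mono {V = V} {W} (nrV , pV≡x) (nrW , pW≡x) V<W = count-mono-< older⇒older (∈-allFin V)
    (dec-false (olderSibling? V V) (<-irrefl refl ∘ proj₁))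
    (dec-true (olderSibling? W V) (V<W , nrV , trans pV≡x (sym pW≡x)))
    where
    older⇒older : ∀ u → does (olderSibling? V u) ≡ true → does (olderSibling? W u) ≡ true
    older⇒older u h with does⇒ (olderSibling? V u) h
    ... | u<V , nr , pu≡pV = dec-true (olderSibling? W u) (<-trans u<V V<W , nr , trans pu≡pV (trans pV≡x (sym pW≡x)))

  -- The root gets the junk value Δ T, which is no label; so the children of the root are labelled by rank.
  labelAt : ℕ → V → ℕ
  labelAt zero v = Δ T
  labelAt (suc t) v = punchInℕ (labelAt t (parent v)) (rank v)

  label : V → ℕ
  label v = labelAt (depth v) v

  label-step : ∀ {v} → NonRoot v → label v ≡ punchInℕ (label (parent v)) (rank v)
  label-step {v} nr = cong (λ k → labelAt k v) (depth-parent nr)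

  label-root : ∀ {v} → ¬ NonRoot v → label v ≡ Δ T
  label-root {v} root = cong (λ k → labelAt k v) (n≤0⇒n≡0 (≮⇒≥ root))

  label<Δ : ∀ {v} → NonRoot v → label v < Δ T
  label<Δ {v} nr with 0 <? depth (parent v)
  ... | yes nrp = begin-strict
    label v                               ≡⟨ label-step nr ⟩
    punchInℕ (label (parent v)) (rank v)  ≤⟨ punchInℕ≤suc _ (rank v) ⟩
    suc (rank v)                          ≤⟨ rank<children nr ⟩
    children (parent v)                   <⟨ children<degree nrp ⟩
    degree T (parent v)                   ≤⟨ degree≤Δ T (parent v) ⟩
    Δ T                                   ∎
    where open ≤-Reasoning
  ... | no root = begin-strict
    label v                               ≡⟨ label-step nr ⟩
    punchInℕ (label (parent v)) (rank v)  ≡⟨ cong (λ L → punchInℕ L (rank v)) (label-root root) ⟩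
    punchInℕ (Δ T) (rank v)               ≡⟨ punchInℕ-< rank<Δ ⟩
    rank v                                <⟨ rank<Δ ⟩
    Δ T                                   ∎
    where
    open ≤-Reasoning
    rank<Δ : rank v < Δ T
    rank<Δ = <-≤-trans (rank<children nr) (≤-trans (children≤degree (parent v)) (degree≤Δ T (parent v)))

  label≢parent : ∀ {v} → NonRoot v → label v ≢ label (parent v)
  label≢parent {v} nr eq = punchInℕ-≢ (label (parent v)) (rank v) (trans (sym (label-step nr)) eq)

  sibling-label≡⇒rank≡ : ∀ {x V W} → ChildOf x V → ChildOf x W → label V ≡ label W → rank V ≡ rank W
  sibling-label≡⇒rank≡ {x} {V} {W} (nrV , pV≡x) (nrW , pW≡x) lV≡lW =
    punchInℕ-injective (label x) (rank V) (rank W) (begin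
      punchInℕ (label x) (rank V)           ≡⟨ cong (λ y → punchInℕ (label y) (rank V)) pV≡x ⟨
      punchInℕ (label (parent V)) (rank V)  ≡⟨ label-step nrV ⟨
      label V                               ≡⟨ lV≡lW ⟩
      label W                               ≡⟨ label-step nrW ⟩
      punchInℕ (label (parent W)) (rank W)  ≡⟨ cong (λ y → punchInℕ (label y) (rank W)) pW≡x ⟩
      punchInℕ (label x) (rank W)           ∎)
    where open ≡-Reasoning

  label-sibling : ∀ {x V W} → ChildOf x V → ChildOf x W → V ≢ W → label V ≢ label W
  label-sibling {V = V} {W} cV cW V≢W lV≡lW with <-cmp (toℕ V) (toℕ W)
  ... | tri< V<W _ _ = <-irrefl (sibling-label≡⇒rank≡ cV cW lV≡lW) (rank-mono cV cW V<W)
  ... | tri≈ _ V≡W _ = V≢W (toℕ-injective V≡W)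
  ... | tri> _ _ W<V = <-irrefl (sibling-label≡⇒rank≡ cW cV (sym lV≡lW)) (rank-mono cW cV W<V)

  OnParentEdge : V → V → Set
  OnParentEdge v a = a ≡ v ⊎ a ≡ parent v

  label-injective-at : ∀ {V W a} → NonRoot V → NonRoot W → OnParentEdge V a → OnParentEdge W a →
    label V ≡ label W → V ≡ W
  label-injective-at _ _ (inj₁ refl) (inj₁ refl) _ = refl
  label-injective-at _ nrW (inj₁ refl) (inj₂ refl) l≡ = contradiction (sym l≡) (label≢parent nrW)
  label-injective-at nrV _ (inj₂ refl) (inj₁ refl) l≡ = contradiction l≡ (label≢parent nrV)
  label-injective-at {V} {W} nrV nrW (inj₂ a≡pV) (inj₂ a≡pW) l≡ with V ≟ W
  ... | yes V≡W = V≡W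
  ... | no V≢W = contradiction l≡ (label-sibling (nrV , sym a≡pV) (nrW , sym a≡pW) V≢W)

  ⟦_⟧ : {A : Set} → Dec A → Parity
  ⟦ a? ⟧ = if does a? then 1ℙ else 0ℙ

  pathParityAt : ℕ → ℕ → V → Parity
  pathParityAt k zero v = 0ℙ
  pathParityAt k (suc t) v = ⟦ label v ℕ.≟ k ⟧ ⊕ pathParityAt k t (parent v)

  pathParity : ℕ → V → Parity
  pathParity k v = pathParityAt k (depth v) v

  ⟦⟧-yes : {A : Set} (a? : Dec A) → A → ⟦ a? ⟧ ≡ 1ℙ
  ⟦⟧-yes a? a = cong (λ b → if b then 1ℙ else 0ℙ) (dec-true a? a)

  ⟦⟧-no : {A : Set} (a? : Dec A) → ¬ A → ⟦ a? ⟧ ≡ 0ℙ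
  ⟦⟧-no a? ¬a = cong (λ b → if b then 1ℙ else 0ℙ) (dec-false a? ¬a)

  pathParity-step : ∀ {v} k → NonRoot v → pathParity k v ≡ ⟦ label v ℕ.≟ k ⟧ ⊕ pathParity k (parent v)
  pathParity-step {v} k nr = cong (λ t → pathParityAt k t v) (depth-parent nr)

  pathParity-own : ∀ {v} → NonRoot v → pathParity (label v) v ≡ pathParity (label v) (parent v) ⁻¹
  pathParity-own {v} nr =
    trans (pathParity-step (label v) nr)
      (cong (_⊕ pathParity (label v) (parent v)) (⟦⟧-yes (label v ℕ.≟ label v) refl))

  pathParity-other : ∀ {v k} → NonRoot v → label v ≢ k → pathParity k v ≡ pathParity k (parent v)
  pathParity-other {v} {k} nr l≢k =
    trans (pathParity-step k nr) (cong (_⊕ pathParity k (parent v)) (⟦⟧-no (label v ℕ.≟ k) l≢k))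

  phase : V → Parity
  phase v = parity (depth v) ⊕ pathParity (label v) v

  phase-one-up : ∀ {x w} → ChildOf x w → phase w ≡ parity (depth x) ⁻¹ ⊕ pathParity (label w) x ⁻¹
  phase-one-up {x} cw@(nr , refl) =
    cong₂ _⊕_ (trans (cong parity (childOf-depth cw)) (parity-suc (depth x))) (pathParity-own nr)

  phase-two-up : ∀ {v} → NonRoot v → NonRoot (parent v) →
    phase v ≡ parity (depth (parent (parent v))) ⊕ pathParity (label v) (parent (parent v)) ⁻¹
  phase-two-up {v} nr nrp = cong₂ _⊕_ (cong parity (trans (depth-parent nr) (cong suc (depth-parent nrp))))
    (trans (pathParity-own nr) (cong _⁻¹ (pathParity-other nrp (label≢parent nr ∘ sym))))

  phase-grandparent : ∀ {v} → NonRoot v → NonRoot (parent v) → label v ≡ label (parent (parent v)) →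
    phase v ≡ phase (parent (parent v)) ⁻¹
  phase-grandparent {v} nr nrp l≡ = begin
    phase v                                         ≡⟨ phase-two-up nr nrp ⟩
    parity (depth g) ⊕ pathParity (label v) g ⁻¹    ≡⟨ p⊕q⁻¹≡[p⊕q]⁻¹ (parity (depth g)) (pathParity (label v) g) ⟩
    (parity (depth g) ⊕ pathParity (label v) g) ⁻¹  ≡⟨ cong (λ k → (parity (depth g) ⊕ pathParity k g) ⁻¹) l≡ ⟩
    phase g ⁻¹                                      ∎
    where
    open ≡-Reasoning
    g = parent (parent v)

  phase-uncle : ∀ {v w} → NonRoot v → NonRoot (parent v) → ChildOf (parent (parent v)) w → label v ≡ label w →
    phase v ≡ phase w ⁻¹
  phase-uncle {v} {w} nr nrp cw l≡ = trans (sym (⁻¹-involutive (phase v))) (cong _⁻¹ (sym (begin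
    phase w                                           ≡⟨ phase-one-up cw ⟩
    parity (depth g) ⁻¹ ⊕ pathParity (label w) g ⁻¹  ≡⟨ p⁻¹⊕q≡[p⊕q]⁻¹ (parity (depth g)) (pathParity (label w) g ⁻¹) ⟩
    (parity (depth g) ⊕ pathParity (label w) g ⁻¹) ⁻¹ ≡⟨ cong (λ k → (parity (depth g) ⊕ pathParity k g ⁻¹) ⁻¹) l≡ ⟨
    (parity (depth g) ⊕ pathParity (label v) g ⁻¹) ⁻¹ ≡⟨ cong _⁻¹ (phase-two-up nr nrp) ⟨
    phase v ⁻¹                                        ∎)))
    where
    open ≡-Reasoning
    g = parent (parent v)

  close-via-parent : ∀ {V W a} → NonRoot V → NonRoot W → OnParentEdge V a → NonRoot a → OnParentEdge W (parent a) →
    label V ≡ label W → phase V ≡ phase W → V ≡ W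
  close-via-parent nrV nrW (inj₁ refl) _ iW l≡ _ = label-injective-at nrV nrW (inj₂ refl) iW l≡
  close-via-parent nrV _ (inj₂ refl) nra (inj₁ refl) l≡ ph≡ =
    contradiction (trans (sym ph≡) (phase-grandparent nrV nra l≡)) (p≢p⁻¹ _)
  close-via-parent nrV nrW (inj₂ refl) nra (inj₂ g≡pW) l≡ ph≡ =
    contradiction (trans (sym ph≡) (phase-uncle nrV nra (nrW , sym g≡pW) l≡)) (p≢p⁻¹ _)

  label-phase-close : ∀ {V W a a′} → NonRoot V → NonRoot W → OnParentEdge V a → OnParentEdge W a′ →
    Close (adj T) a a′ → label V ≡ label W → phase V ≡ phase W → V ≡ W
  label-phase-close nrV nrW iV iW (inj₁ refl) l≡ _ = label-injective-at nrV nrW iV iW l≡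
  label-phase-close nrV nrW iV iW (inj₂ aa′) l≡ ph≡ with edge-parent aa′
  ... | inj₁ (nra , refl) = close-via-parent nrV nrW iV nra iW l≡ ph≡
  ... | inj₂ (nra′ , refl) = sym (close-via-parent nrW nrV iW nra′ iV (sym l≡) (sym ph≡))

  childEnd : V → V → V
  childEnd a b with childOf? b a
  ... | yes _ = a
  ... | no _ = b

  ParentEdge : V → V → V → Set
  ParentEdge c a b = (a ≡ c × b ≡ parent c) ⊎ (a ≡ parent c × b ≡ c)

  childEnd-edge : ∀ {a b} → Adj a b → NonRoot (childEnd a b) × ParentEdge (childEnd a b) a b
  childEnd-edge {a} {b} ab with childOf? b a
  ... | yes (nra , pa≡b) = nra , inj₁ (refl , sym pa≡b)
  ... | no ¬ba with edge-parent ab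
  ...   | inj₁ ba = contradiction ba ¬ba
  ...   | inj₂ (nrb , pb≡a) = nrb , inj₂ (sym pb≡a , refl)

  childEnd-sym : ∀ {a b} → Adj a b → childEnd a b ≡ childEnd b a
  childEnd-sym {a} {b} ab with childOf? b a | childOf? a b
  ... | yes ba | yes ab′ = ⊥-elim (childOf-asym ab′ ba)
  ... | yes _ | no _ = refl
  ... | no _ | yes _ = refl
  ... | no ¬ba | no ¬ab = ⊥-elim ([ ¬ba , ¬ab ]′ (edge-parent ab))

  parentEdge-onˡ : ∀ {c a b} → ParentEdge c a b → OnParentEdge c a
  parentEdge-onˡ (inj₁ (a≡c , _)) = inj₁ a≡c
  parentEdge-onˡ (inj₂ (a≡pc , _)) = inj₂ a≡pc

  parentEdge-sameEdge : ∀ {c a b a′ b′} → ParentEdge c a b → ParentEdge c a′ b′ → SameEdge a b a′ b′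
  parentEdge-sameEdge (inj₁ (refl , refl)) (inj₁ (refl , refl)) = inj₁ (refl , refl)
  parentEdge-sameEdge (inj₁ (refl , refl)) (inj₂ (refl , refl)) = inj₂ (refl , refl)
  parentEdge-sameEdge (inj₂ (refl , refl)) (inj₁ (refl , refl)) = inj₂ (refl , refl)
  parentEdge-sameEdge (inj₂ (refl , refl)) (inj₂ (refl , refl)) = inj₁ (refl , refl)

  adj⇒parity≢ : ∀ {a b} → Adj a b → parity (depth a) ≢ parity (depth b)
  adj⇒parity≢ {a} {b} ab with edge-parent ab
  ... | inj₁ ba = λ eq → p≢p⁻¹ _ (trans (sym eq) (trans (cong parity (childOf-depth ba)) (parity-suc (depth b))))
  ... | inj₂ ab′ = λ eq → p≢p⁻¹ _ (trans eq (trans (cong parity (childOf-depth ab′)) (parity-suc (depth a))))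

-- The colouring of T □ C₆

module ProductColouring {T : Graph} (R : RootedTree T) where
  open RootedTree R
  open EdgeLabelling R

  private
    Adj = Adjacent T

  V : Set
  V = Fin (n T) × Fin 6

  _∼_ : V → V → Bool
  _∼_ = □adj (adj T) C6adj (λ a b → ⌊ a ≟ b ⌋) (λ u v → ⌊ u ≟ v ⌋)

  columnColour : Fin (n T) → Fin 6 → Fin 6 → ℕ
  columnColour a i j = (toℕ i + toℕ j) % 3 + bit (parity (depth a)) * 3

  treeColour : Fin (n T) → Fin 6 → ℕ
  treeColour v i = 6 + (bit (phase v ⊕ parity (toℕ i)) + label v * 2)

  colour : V → V → ℕ
  colour (a , i) (b , j) with a ≟ b
  ... | yes _ = columnColour a i j
  ... | no _ = treeColour (childEnd a b) i

  colour-column : ∀ a i j → colour (a , i) (a , j) ≡ columnColour a i j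
  colour-column a i j with a ≟ a
  ... | yes _ = refl
  ... | no a≢a = contradiction refl a≢a

  colour-tree : ∀ {a b} i j → a ≢ b → colour (a , i) (b , j) ≡ treeColour (childEnd a b) i
  colour-tree {a} {b} i j a≢b with a ≟ b
  ... | yes a≡b = contradiction a≡b a≢b
  ... | no _ = refl

  columnColour<6 : ∀ a i j → columnColour a i j < 6
  columnColour<6 a i j = +-mono-<-≤ (m%n<n (toℕ i + toℕ j) 3) (*-monoˡ-≤ 3 (≤-pred (bit<2 (parity (depth a)))))

  treeColour≥6 : ∀ v i → 6 ≤ treeColour v i
  treeColour≥6 v i = m≤m+n 6 _

  colours : ℕ
  colours = 6 + Δ T * 2

  treeColour< : ∀ {v} i → NonRoot v → treeColour v i < colours
  treeColour< {v} i nr = +-monoʳ-< 6 (≤-trans (+-monoˡ-< (label v * 2) (bit<2 _)) (*-monoˡ-≤ 2 (label<Δ nr)))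

  columnColour-injective : ∀ a i j a′ i′ j′ → columnColour a i j ≡ columnColour a′ i′ j′ →
    (toℕ i + toℕ j) % 3 ≡ (toℕ i′ + toℕ j′) % 3 × parity (depth a) ≡ parity (depth a′)
  columnColour-injective a i j a′ i′ j′ eq = proj₁ r≡×q≡ , bit-injective (proj₂ r≡×q≡)
    where r≡×q≡ = divMod-injective 3 (m%n<n (toℕ i + toℕ j) 3) (m%n<n (toℕ i′ + toℕ j′) 3) eq

  treeColour-injective : ∀ v i w i′ → treeColour v i ≡ treeColour w i′ →
    phase v ⊕ parity (toℕ i) ≡ phase w ⊕ parity (toℕ i′) × label v ≡ label w
  treeColour-injective v i w i′ eq = bit-injective (proj₁ r≡×q≡) , proj₂ r≡×q≡
    where
    r≡×q≡ = divMod-injective 2 (bit<2 (phase v ⊕ parity (toℕ i))) (bit<2 (phase w ⊕ parity (toℕ i′)))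
      (+-cancelˡ-≡ 6 _ _ eq)

  private
    ∼-edge : ∀ {a i b j} → (a , i) ∼ (b , j) ≡ true → (a ≡ b × C6adj i j ≡ true) ⊎ (i ≡ j × Adj a b)
    ∼-edge {a} {i} {b} {j} = □-edge _≟_ _≟_ (adj T) C6adj {a} {i} {b} {j}


  ∼-sym : ∀ {x y} → x ∼ y ≡ true → y ∼ x ≡ true
  ∼-sym {x} {y} = □-sym _≟_ _≟_ (adj T) C6adj (adjacent-sym T) (λ {i} {j} → C6-sym i j) {x} {y}

  colour-sym : ∀ {x y} → x ∼ y ≡ true → colour x y ≡ colour y x
  colour-sym {a , i} {b , j} e with ∼-edge {a} {i} {b} {j} e
  ... | inj₁ (refl , _) = begin
    colour (a , i) (a , j)  ≡⟨ colour-column a i j ⟩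
    columnColour a i j      ≡⟨ cong (λ m → m % 3 + bit (parity (depth a)) * 3) (+-comm (toℕ i) (toℕ j)) ⟩
    columnColour a j i      ≡⟨ colour-column a j i ⟨
    colour (a , j) (a , i)  ∎
    where open ≡-Reasoning
  ... | inj₂ (refl , ab) = begin
    colour (a , i) (b , i)    ≡⟨ colour-tree i i (adjacent⇒≢ T ab) ⟩
    treeColour (childEnd a b) i  ≡⟨ cong (λ c → treeColour c i) (childEnd-sym ab) ⟩
    treeColour (childEnd b a) i  ≡⟨ colour-tree i i (adjacent⇒≢ T ab ∘ sym) ⟨
    colour (b , i) (a , i)    ∎
    where open ≡-Reasoning

  colour< : ∀ {x y} → x ∼ y ≡ true → colour x y < colours
  colour< {a , i} {b , j} e with ∼-edge {a} {i} {b} {j} e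
  ... | inj₁ (refl , _) =
    subst (_< colours) (sym (colour-column a i j)) (<-≤-trans (columnColour<6 a i j) (m≤m+n 6 _))
  ... | inj₂ (refl , ab) =
    subst (_< colours) (sym (colour-tree i i (adjacent⇒≢ T ab))) (treeColour< i (proj₁ (childEnd-edge ab)))

  column≢tree : ∀ a i j v k → columnColour a i j ≢ treeColour v k
  column≢tree a i j v k = <⇒≢ (<-≤-trans (columnColour<6 a i j) (treeColour≥6 v k))

  column-close : ∀ {a a′ i j i′ j′} → C6adj i j ≡ true → C6adj i′ j′ ≡ true →
    columnColour a i j ≡ columnColour a′ i′ j′ → Close _∼_ (a , i) (a′ , i′) →
    SameEdge (a , i) (a , j) (a′ , i′) (a′ , j′)
  column-close {i = i} {j} {i′} {j′} ij ij′ eq (inj₁ refl) =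
    sameEdge-map (_ ,_) (C6-strong i j i′ j′ ij ij′ (inj₁ refl) (proj₁ (columnColour-injective _ i j _ i′ j′ eq)))
  column-close {a} {a′} {i} {j} {i′} {j′} ij ij′ eq (inj₂ e) with ∼-edge {a} {i} {a′} {i′} e
  ... | inj₁ (refl , ii′) =
    sameEdge-map (_ ,_) (C6-strong i j i′ j′ ij ij′ (inj₂ ii′) (proj₁ (columnColour-injective _ i j _ i′ j′ eq)))
  ... | inj₂ (refl , aa′) = contradiction (proj₂ (columnColour-injective a i j a′ i′ j′ eq)) (adj⇒parity≢ aa′)

  tree-same-layer : ∀ {a b a′ b′ i} → Adj a b → Adj a′ b′ →
    treeColour (childEnd a b) i ≡ treeColour (childEnd a′ b′) i → Close (adj T) a a′ →
    SameEdge (a , i) (b , i) (a′ , i) (b′ , i)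
  tree-same-layer {a} {b} {a′} {b′} {i} ab ab′ eq cl
    with childEnd-edge ab | childEnd-edge ab′ | treeColour-injective _ i _ i eq
  ... | nrV , eV | nrW , eW | ph≡ , l≡ =
    sameEdge-map (_, i) (parentEdge-sameEdge eV (subst (λ c → ParentEdge c a′ b′) (sym V≡W) eW))
    where
    V≡W = label-phase-close nrV nrW (parentEdge-onˡ eV) (parentEdge-onˡ eW) cl l≡
      (Parity.+-cancelʳ-≡ (parity (toℕ i)) (phase (childEnd a b)) (phase (childEnd a′ b′)) ph≡)

  tree-adjacent-layers : ∀ {a b b′ i i′} → Adj a b → Adj a b′ → C6adj i i′ ≡ true →
    treeColour (childEnd a b) i ≢ treeColour (childEnd a b′) i′
  tree-adjacent-layers {a} {b} {b′} {i} {i′} ab ab′ ii′ eq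
    with childEnd-edge ab | childEnd-edge ab′ | treeColour-injective _ i _ i′ eq
  ... | nrV , eV | nrW , eW | ph≡ , l≡ =
    C6-parity i i′ ii′ (Parity.+-cancelˡ-≡ (phase (childEnd a b′)) (parity (toℕ i)) (parity (toℕ i′))
      (trans (cong (λ c → phase c ⊕ parity (toℕ i)) (sym V≡W)) ph≡))
    where
    V≡W = label-injective-at nrV nrW (parentEdge-onˡ eV) (parentEdge-onˡ eW) l≡

  tree-close : ∀ {a b a′ b′ i i′} → Adj a b → Adj a′ b′ →
    treeColour (childEnd a b) i ≡ treeColour (childEnd a′ b′) i′ → Close _∼_ (a , i) (a′ , i′) →
    SameEdge (a , i) (b , i) (a′ , i′) (b′ , i′)
  tree-close ab ab′ eq (inj₁ refl) = tree-same-layer ab ab′ eq (inj₁ refl)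
  tree-close {a} {a′ = a′} {i = i} {i′} ab ab′ eq (inj₂ e) with ∼-edge {a} {i} {a′} {i′} e
  ... | inj₁ (refl , ii′) = contradiction eq (tree-adjacent-layers {i = i} {i′} ab ab′ ii′)
  ... | inj₂ (refl , aa′) = tree-same-layer ab ab′ eq (inj₂ aa′)

  colour-close : ∀ {x y x′ y′} → x ∼ y ≡ true → x′ ∼ y′ ≡ true → colour x y ≡ colour x′ y′ →
    Close _∼_ x x′ → SameEdge x y x′ y′
  colour-close {a , i} {b , j} {a′ , i′} {b′ , j′} e e′ eq cl
    with ∼-edge {a} {i} {b} {j} e | ∼-edge {a′} {i′} {b′} {j′} e′
  ... | inj₁ (refl , ij) | inj₁ (refl , ij′) =
    column-close ij ij′ (trans (sym (colour-column a i j)) (trans eq (colour-column a′ i′ j′))) cl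
  ... | inj₁ (refl , _) | inj₂ (refl , ab′) = contradiction
    (trans (sym (colour-column a i j)) (trans eq (colour-tree i′ i′ (adjacent⇒≢ T ab′)))) (column≢tree a i j _ i′)
  ... | inj₂ (refl , ab) | inj₁ (refl , _) = contradiction
    (trans (sym (colour-column a′ i′ j′)) (trans (sym eq) (colour-tree i i (adjacent⇒≢ T ab))))
    (column≢tree a′ i′ j′ _ i)
  ... | inj₂ (refl , ab) | inj₂ (refl , ab′) =
    tree-close ab ab′ (trans (sym (colour-tree i i (adjacent⇒≢ T ab))) (trans eq (colour-tree i′ i′ (adjacent⇒≢ T ab′))))
      cl

  strongColouring : StrongEdgeColoring _∼_ colours
  strongColouring = strongEdgeColoring (≡-dec _≟_ _≟_) (λ {x} {y} → ∼-sym {x} {y}) colour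
    (λ {x} {y} → colour-sym {x} {y}) colours (λ {x} {y} → colour< {x} {y})
    (λ {u} {v} {x} {y} → colour-close {u} {v} {x} {y})

fin-or-empty : ∀ m → Fin m ⊎ ¬ Fin m
fin-or-empty zero = inj₂ λ ()
fin-or-empty (suc m) = inj₁ Fin.zero

theorem10 : (T : Graph) → IsTree T →
    Σ ℕ λ k → (k ≤ 2 * Δ T + 6) ×
      StrongEdgeColoring (□adj (adj T) C6adj (λ a b → ⌊ a ≟ b ⌋) (λ u v → ⌊ u ≟ v ⌋)) k
theorem10 T tree with fin-or-empty (n T)
... | inj₁ root = colours , ≤-reflexive (trans (+-comm 6 (Δ T * 2)) (cong (_+ 6) (*-comm (Δ T) 2))) , strongColouring
  where open ProductColouring (Rooting.rootedTree T tree root)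
... | inj₂ empty = 0 , z≤n , strongEdgeColoring-empty (empty ∘ proj₁)
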